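{- Let $\mathsf{C}$ be an infinite nice graph. Then $\mathsf{M}(\mathsf{C})$ has burden at least $\aleph_{0- }$; that is, for every positive integer $m$ there is an inp-pattern of depth $m$ in a single group-sorted variable.
   Context: Fix an odd prime $p$. A graph is nice if it has at least two vertices, no triangles or squares, and for distinct vertices $v_1,v_2$ there is a vertex $u\notin\{v_1,v_2\}$ adjacent to $v_1$ but not $v_2$. $\mathsf{M}(\mathsf{C})$ is the group generated freely in the variety of $2$-nilpotent groups of exponent $p$ by the vertices of $\mathsf{C}$, with only relations that two generators commute iff adjacent. An inp-pattern of depth $m$ in the variable $x$ (in the theory of $\mathsf{M}(\mathsf{C})$, allowing imaginary parameters) consists of formulas $\varphi_i(x,y_i)$, $i<m$, parameters $(a_{i,j})_{i<m,j<\omega}$ and integers $k_i$ such that each row $\{\varphi_i(x,a_{i,j}):j<\omega\}$ is $k_i$-inconsistent and for every $f:m\to\omega$ the set $\{\varphi_i(x,a_{i,f(i)}):i<m\}$ is consistent. Burden at least $\aleph_{0- }$ means there are inp-patterns of every finite depth in a single variable. -}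

module Defs where

open import Level using (0ℓ)
open import Data.Nat using (ℕ; zero; suc)
open import Data.Nat.Primality using (Prime)
open import Data.Fin using (Fin)
open import Data.Vec.Functional using (_∷_)
open import Data.Product using (Σ; ∃; _×_)
open import Data.Sum using (_⊎_)
open import Relation.Nullary using (¬_)
open import Relation.Binary.PropositionalEquality using (_≡_; _≢_)
open import Function.Definitions using (Injective)
open import Algebra.Bundles using (Group)
open import Algebra.Morphism.Structures using (module GroupMorphisms)

record Graph : Set₁ where
  field
    Vertex : Set
    _~_    : Vertex → Vertex → Set
    ~-sym  : ∀ {v w} → v ~ w → w ~ v
    ~-irr  : ∀ {v} → ¬ (v ~ v)

module _ (C : Graph) where
  open Graph C

  InfiniteGraph : Set
  InfiniteGraph = Σ (ℕ → Vertex) λ e → Injective _≡_ _≡_ e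

  AtLeastTwoVertices : Set
  AtLeastTwoVertices = Σ Vertex λ v → Σ Vertex λ w → v ≢ w

  NoTriangles : Set
  NoTriangles = ∀ a b c → a ~ b → b ~ c → c ~ a → ⊥'
    where open import Data.Empty renaming (⊥ to ⊥')

  -- no 4-cycles a - b - c - d - a (with a ≠ c, b ≠ d; the other
  -- distinctness conditions follow from irreflexivity)
  NoSquares : Set
  NoSquares = ∀ a b c d → a ≢ c → b ≢ d →
              a ~ b → b ~ c → c ~ d → d ~ a → ⊥'
    where open import Data.Empty renaming (⊥ to ⊥')

  Separating : Set
  Separating = ∀ v₁ v₂ → v₁ ≢ v₂ →
               Σ Vertex λ u → u ≢ v₁ × u ≢ v₂ × u ~ v₁ × ¬ (u ~ v₂)

  record Nice : Set where
    field
      twoVertices : AtLeastTwoVertices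
      noTriangles : NoTriangles
      noSquares   : NoSquares
      separating  : Separating

module _ (G : Group 0ℓ 0ℓ) where
  open Group G

  _^'_ : Carrier → ℕ → Carrier
  g ^' zero  = ε
  g ^' suc n = g ∙ (g ^' n)

  comm : Carrier → Carrier → Carrier
  comm g h = ((g ⁻¹ ∙ h ⁻¹) ∙ g) ∙ h

  Nilpotent2 : Set
  Nilpotent2 = ∀ g h k → comm (comm g h) k ≈ ε

  ExponentDivides : ℕ → Set
  ExponentDivides p = ∀ g → (g ^' p) ≈ ε

  InVariety : ℕ → Set
  InVariety p = Nilpotent2 × ExponentDivides p

IsGroupHom : (G H : Group 0ℓ 0ℓ) → (Group.Carrier G → Group.Carrier H) → Set
IsGroupHom G H h =
  GroupMorphisms.IsGroupHomomorphism (Group.rawGroup G) (Group.rawGroup H) h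

-- (G , ι) is M(C): the group generated freely in the variety of 2-nilpotent
-- groups of exponent p by the vertices of C, subject only to the relations
-- [v,w] = 1 for adjacent v, w  (stated via its universal property).
record IsM (p : ℕ) (C : Graph) (G : Group 0ℓ 0ℓ)
           (ι : Graph.Vertex C → Group.Carrier G) : Set₁ where
  open Graph C
  open Group G
  field
    inVariety : InVariety G p
    adjCommute : ∀ {v w} → v ~ w → (ι v ∙ ι w) ≈ (ι w ∙ ι v)
    universal :
      (H : Group 0ℓ 0ℓ) → InVariety H p →
      (f : Vertex → Group.Carrier H) →
      (∀ {v w} → v ~ w →
         Group._≈_ H (Group._∙_ H (f v) (f w)) (Group._∙_ H (f w) (f v))) →
      Σ (Carrier → Group.Carrier H) λ h →
        IsGroupHom G H h × (∀ v → Group._≈_ H (h (ι v)) (f v))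
    uniqueness :
      (H : Group 0ℓ 0ℓ) → (h₁ h₂ : Carrier → Group.Carrier H) →
      IsGroupHom G H h₁ → IsGroupHom G H h₂ →
      (∀ v → Group._≈_ H (h₁ (ι v)) (h₂ (ι v))) →
      ∀ g → Group._≈_ H (h₁ g) (h₂ g)

data Term (n : ℕ) : Set where
  var : Fin n → Term n
  one : Term n
  mul : Term n → Term n → Term n
  inv : Term n → Term n

data Formula (n : ℕ) : Set where
  eq   : Term n → Term n → Formula n
  neg  : Formula n → Formula n
  conj : Formula n → Formula n → Formula n
  disj : Formula n → Formula n → Formula n
  exi  : Formula (suc n) → Formula n
  all  : Formula (suc n) → Formula n

module _ (G : Group 0ℓ 0ℓ) where
  open Group G

  eval : ∀ {n} → (Fin n → Carrier) → Term n → Carrier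
  eval ρ (var i)   = ρ i
  eval ρ one       = ε
  eval ρ (mul s t) = eval ρ s ∙ eval ρ t
  eval ρ (inv t)   = eval ρ t ⁻¹

  Sat : ∀ {n} → Formula n → (Fin n → Carrier) → Set
  Sat (eq s t)   ρ = eval ρ s ≈ eval ρ t
  Sat (neg φ)    ρ = ¬ Sat φ ρ
  Sat (conj φ ψ) ρ = Sat φ ρ × Sat ψ ρ
  Sat (disj φ ψ) ρ = Sat φ ρ ⊎ Sat ψ ρ
  Sat (exi φ)    ρ = Σ Carrier λ x → Sat φ (x ∷ ρ)
  Sat (all φ)    ρ = ∀ x → Sat φ (x ∷ ρ)

  -- An inp-pattern of depth m in one (group-sorted) variable x.
  -- Row i: formula φ i (x , y) with y of length arity i (x is variable 0),
  -- parameters a i j (j : ℕ), and integer k i.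
  record InpPattern (m : ℕ) : Set where
    field
      arity : Fin m → ℕ
      φ     : (i : Fin m) → Formula (suc (arity i))
      a     : (i : Fin m) → ℕ → (Fin (arity i) → Carrier)
      k     : Fin m → ℕ
      rowInconsistent :
        (i : Fin m) (s : Fin (k i) → ℕ) → Injective _≡_ _≡_ s →
        ¬ (Σ Carrier λ x → ∀ t → Sat (φ i) (x ∷ a i (s t)))
      pathConsistent :
        (f : Fin m → ℕ) →
        Σ Carrier λ x → ∀ i → Sat (φ i) (x ∷ a i (f i))

  BurdenAtLeastℵ₀₋ : Set
  BurdenAtLeastℵ₀₋ = ∀ m → InpPattern m

-- Choose distinct vertices W i 0, W i 1 (i < m) and U j (j ∈ ℕ), and let entry (i, j) of
-- the pattern be  ∃t. x = ∏ᵢ' [tᵢ', W i' 0] [tᵢ', W i' 1] ∧ tᵢ = U j.  A path f is realised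
-- by x = ∏ᵢ [U (f i), W i 0] [U (f i), W i 1]. If two entries (i, j), (i, j') with j ≠ j'
-- were realised by the same x then, C having no squares, some U j would be non-adjacent
-- to some W i b. Sending these two vertices to the generators of the Heisenberg group
-- mod p and all other vertices to 1 defines a homomorphism on M(C) mapping x both to
-- [U j, W i b] and to 1; but this commutator is twice a central generator, hence
-- nontrivial as p is odd.
--
-- Vertex equality is undecidable, so that homomorphism is realised through a group of
-- words in the vertices, compared via their evaluations in the Heisenberg group.
module Submission where

open import Level using (0ℓ)
open import Data.Nat as Nat using (ℕ; zero; suc; nonTrivial⇒≢1)
open import Data.Nat.Divisibility using (_∣_)
open import Data.Nat.Properties using (<⇒≢; <-≤-trans; m≤m+n; +-cancelˡ-≡)
open import Data.Nat.Primality using (Prime; prime⇒nonTrivial; irreducible[2])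
import Data.Integer as ℤ
import Data.Integer.Divisibility.Signed as Signed
open import Data.Integer.Tactic.RingSolver using (solve-∀)
open import Data.Bool using (Bool; true; false; not)
import Data.List as List
open import Data.List.Properties using (++-assoc; ++-identityʳ)
open import Data.Fin using (Fin; zero; suc; toℕ; combine; _↑ˡ_; _↑ʳ_)
open import Data.Fin.Properties using (suc-injective; toℕ-injective; toℕ<n; combine-injective)
import Data.Vec.Functional as Vector
open import Data.Product using (∃; _×_; _,_; proj₁; proj₂)
open import Data.Product.Properties using (×-≡,≡→≡)
open import Data.Sum using (_⊎_; inj₁; inj₂; [_,_]′)
open import Data.Sum.Properties using (inj₁-injective; inj₂-injective)
open import Data.Empty using (⊥; ⊥-elim)
open import Function using (_∘_; case_of_; _⇔_; mk⇔; Equivalence)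
open import Function.Properties.Equivalence using () renaming (trans to ⇔-trans)
open import Function.Related.Propositional using (equivalence)
open import Data.Product.Function.Dependent.Propositional using () renaming (congˡ to ∃-congˡ)
open import Function.Definitions using (Injective)
open import Relation.Nullary using (¬_; Dec; yes; no)
open import Relation.Nullary.Decidable using (¬¬-excluded-middle)
open import Relation.Nullary.Negation using (¬¬-Monad; ¬¬-map)
open import Relation.Binary.PropositionalEquality as ≡ using (_≡_; _≢_)
open import Effect.Monad using (RawMonad)
open import Algebra.Bundles using (Group)
open import Algebra.Morphism.Structures using (module GroupMorphisms)
open import Defs

module CommutatorProducts (G : Group 0ℓ 0ℓ) where
  open Group G
  open import Algebra.Properties.Group G using (ε⁻¹≈ε)
  open import Algebra.Properties.Monoid.Sum monoid public using (sum)
  open import Algebra.Properties.Monoid.Sum monoid using (sum-cong-≋; sum-replicate-zero)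
  open import Relation.Binary.Reasoning.Setoid setoid

  comm-cong : ∀ {g g' h h'} → g ≈ g' → h ≈ h' → comm G g h ≈ comm G g' h'
  comm-cong g≈g' h≈h' = ∙-cong (∙-cong (∙-cong (⁻¹-cong g≈g') (⁻¹-cong h≈h')) g≈g') h≈h'

  comm-identityˡ : ∀ g → comm G ε g ≈ ε
  comm-identityˡ g = begin
    ((ε ⁻¹ ∙ g ⁻¹) ∙ ε) ∙ g ≈⟨ ∙-congʳ (identityʳ _) ⟩
    (ε ⁻¹ ∙ g ⁻¹) ∙ g       ≈⟨ ∙-congʳ (∙-congʳ ε⁻¹≈ε) ⟩
    (ε ∙ g ⁻¹) ∙ g          ≈⟨ ∙-congʳ (identityˡ _) ⟩
    g ⁻¹ ∙ g                ≈⟨ inverseˡ g ⟩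
    ε                       ∎

  comm-identityʳ : ∀ g → comm G g ε ≈ ε
  comm-identityʳ g = begin
    ((g ⁻¹ ∙ ε ⁻¹) ∙ g) ∙ ε ≈⟨ identityʳ _ ⟩
    (g ⁻¹ ∙ ε ⁻¹) ∙ g       ≈⟨ ∙-congʳ (∙-congˡ ε⁻¹≈ε) ⟩
    (g ⁻¹ ∙ ε) ∙ g          ≈⟨ ∙-congʳ (identityʳ _) ⟩
    g ⁻¹ ∙ g                ≈⟨ inverseˡ g ⟩
    ε                       ∎

  sum-trivial : ∀ {n} (f : Fin n → Carrier) → (∀ i → f i ≈ ε) → sum f ≈ ε
  sum-trivial {n} f trivial = trans (sum-cong-≋ trivial) (sum-replicate-zero n)

  sum-single : ∀ {n} (f : Fin n → Carrier) i → (∀ j → j ≢ i → f j ≈ ε) → sum f ≈ f i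
  sum-single f zero    others = begin
    f zero ∙ sum (λ j → f (suc j)) ≈⟨ ∙-congˡ (sum-trivial _ λ j → others (suc j) λ ()) ⟩
    f zero ∙ ε                     ≈⟨ identityʳ _ ⟩
    f zero                         ∎
  sum-single f (suc i) others = begin
    f zero ∙ sum (λ j → f (suc j)) ≈⟨ ∙-congʳ (others zero λ ()) ⟩
    ε ∙ sum (λ j → f (suc j))      ≈⟨ identityˡ _ ⟩
    sum (λ j → f (suc j))          ≈⟨ sum-single _ i (λ j → others (suc j) ∘ (_∘ suc-injective)) ⟩
    f (suc i)                      ∎

  commProduct : ∀ {m n} → (Fin m → Carrier) → (Fin m → Fin n → Carrier) → Carrier
  commProduct t w = sum λ i → sum λ b → comm G (t i) (w i b)

  commProduct-cong : ∀ {m n} {t t' : Fin m → Carrier} {w w' : Fin m → Fin n → Carrier} →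
                     (∀ i → t i ≈ t' i) → (∀ i b → w i b ≈ w' i b) →
                     commProduct t w ≈ commProduct t' w'
  commProduct-cong t≈t' w≈w' = sum-cong-≋ λ i → sum-cong-≋ λ b → comm-cong (t≈t' i) (w≈w' i b)

  commProduct-single : ∀ {m n} (t : Fin m → Carrier) (w : Fin m → Fin n → Carrier) i b →
                       (∀ i' b' → (i' , b') ≢ (i , b) → w i' b' ≈ ε) →
                       commProduct t w ≈ comm G (t i) (w i b)
  commProduct-single t w i b others =
    trans (sum-single _ i λ i' i'≢i → sum-trivial _ λ b' →
             vanishes (others i' b' (i'≢i ∘ ≡.cong proj₁)))
          (sum-single _ b λ b' b'≢b → vanishes (others i b' (b'≢b ∘ ≡.cong proj₂)))
    where
    vanishes : ∀ {g h} → h ≈ ε → comm G g h ≈ ε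
    vanishes h≈ε = trans (comm-cong refl h≈ε) (comm-identityʳ _)

module CommutatorHomomorphism (G H : Group 0ℓ 0ℓ) (h : Group.Carrier G → Group.Carrier H)
                              (h-hom : IsGroupHom G H h) where
  open Group H
  open GroupMorphisms.IsGroupHomomorphism h-hom
  open import Algebra.Properties.Monoid.Sum monoid using (sum-cong-≋)
  open CommutatorProducts using (sum; commProduct)

  comm-homo : ∀ x y → h (comm G x y) ≈ comm H (h x) (h y)
  comm-homo x y = trans (homo _ y) (∙-cong (trans (homo _ x)
    (∙-cong (trans (homo _ _) (∙-cong (⁻¹-homo x) (⁻¹-homo y))) refl)) refl)

  sum-homo : ∀ {n} (f : Fin n → Group.Carrier G) → h (sum G f) ≈ sum H (λ i → h (f i))
  sum-homo {zero}  f = ε-homo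
  sum-homo {suc n} f = trans (homo _ _) (∙-congˡ (sum-homo (λ i → f (suc i))))

  commProduct-homo : ∀ {m n} t (w : Fin m → Fin n → Group.Carrier G) →
                     h (commProduct G t w) ≈ commProduct H (λ i → h (t i)) (λ i b → h (w i b))
  commProduct-homo t w = trans (sum-homo (λ i → sum G λ b → comm G (t i) (w i b))) (sum-cong-≋ λ i →
    trans (sum-homo (λ b → comm G (t i) (w i b))) (sum-cong-≋ λ b → comm-homo (t i) (w i b)))

module Heisenberg (p : ℕ) where
  open ℤ using (ℤ; +_; _+_; _*_; -_; _-_; 0ℤ; 1ℤ)
  open Signed using (divides; ∣⇒∣ᵤ; ∣m∣n⇒∣m+n; ∣m⇒∣-m; ∣n⇒∣m*n; ∣m⇒∣m*n)
  open ≡ using (refl; subst; cong; trans; module ≡-Reasoning)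

  infix 4 _≡ₚ_
  record _≡ₚ_ (x y : ℤ) : Set where
    constructor mod-p
    field p∣x-y : + p Signed.∣ x - y

  private
    ∣-resp : ∀ {u x y} → u ≡ x - y → + p Signed.∣ u → x ≡ₚ y
    ∣-resp u≡x-y p∣u = mod-p (subst (+ p Signed.∣_) u≡x-y p∣u)

  ≡ₚ-reflexive : ∀ {x y} → x ≡ y → x ≡ₚ y
  ≡ₚ-reflexive {x} refl = mod-p (divides 0ℤ (x-x≡0*p x (+ p)))
    where
    x-x≡0*p : ∀ x p → x - x ≡ 0ℤ * p
    x-x≡0*p = solve-∀

  ≡ₚ-sym : ∀ {x y} → x ≡ₚ y → y ≡ₚ x
  ≡ₚ-sym {x} {y} (mod-p d) = ∣-resp (identity x y) (∣m⇒∣-m d)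
    where
    identity : ∀ x y → - (x - y) ≡ y - x
    identity = solve-∀

  ≡ₚ-trans : ∀ {x y z} → x ≡ₚ y → y ≡ₚ z → x ≡ₚ z
  ≡ₚ-trans {x} {y} {z} (mod-p d) (mod-p d') = ∣-resp (identity x y z) (∣m∣n⇒∣m+n d d')
    where
    identity : ∀ x y z → (x - y) + (y - z) ≡ x - z
    identity = solve-∀

  +-cong : ∀ {x x' y y'} → x ≡ₚ x' → y ≡ₚ y' → x + y ≡ₚ x' + y'
  +-cong {x} {x'} {y} {y'} (mod-p d) (mod-p d') = ∣-resp (identity x x' y y') (∣m∣n⇒∣m+n d d')
    where
    identity : ∀ x x' y y' → (x - x') + (y - y') ≡ (x + y) - (x' + y')
    identity = solve-∀

  -‿cong : ∀ {x x'} → x ≡ₚ x' → - x ≡ₚ - x'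
  -‿cong {x} {x'} (mod-p d) = ∣-resp (identity x x') (∣m⇒∣-m d)
    where
    identity : ∀ x x' → - (x - x') ≡ - x - - x'
    identity = solve-∀

  *-cong : ∀ {x x' y y'} → x ≡ₚ x' → y ≡ₚ y' → x * y ≡ₚ x' * y'
  *-cong {x} {x'} {y} {y'} (mod-p d) (mod-p d') =
    ∣-resp (identity x x' y y') (∣m∣n⇒∣m+n (∣n⇒∣m*n x d') (∣m⇒∣m*n y' d))
    where
    identity : ∀ x x' y y' → x * (y - y') + (x - x') * y' ≡ x * y - x' * y'
    identity = solve-∀

  -- The Heisenberg group built with the alternating cocycle ω rather than a b': powers
  -- are then linear, (a, b, c)ⁿ = (n a, n b, n c), so the exponent divides p for every p,
  -- while [x, y] = (0, 0, 2 ω(x, y)), which is why p has to be odd.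
  H₃ : Set
  H₃ = ℤ × ℤ × ℤ

  ω : H₃ → H₃ → ℤ
  ω (a , b , _) (a' , b' , _) = a * b' - a' * b

  infixl 7 _·_
  _·_ : H₃ → H₃ → H₃
  x@(a , b , c) · y@(a' , b' , c') = (a + a' , b + b' , c + c' + ω x y)

  ε : H₃
  ε = (0ℤ , 0ℤ , 0ℤ)

  _⁻¹ : H₃ → H₃
  (a , b , c) ⁻¹ = (- a , - b , - c)

  infix 4 _≈_
  _≈_ : H₃ → H₃ → Set
  (a , b , c) ≈ (a' , b' , c') = a ≡ₚ a' × b ≡ₚ b' × c ≡ₚ c'

  ≈-reflexive : ∀ {x y} → x ≡ y → x ≈ y
  ≈-reflexive refl = ≡ₚ-reflexive refl , ≡ₚ-reflexive refl , ≡ₚ-reflexive refl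

  ≈-sym : ∀ {x y} → x ≈ y → y ≈ x
  ≈-sym {_ , _ , _} {_ , _ , _} (da , db , dc) = ≡ₚ-sym da , ≡ₚ-sym db , ≡ₚ-sym dc

  ≈-trans : ∀ {x y z} → x ≈ y → y ≈ z → x ≈ z
  ≈-trans {_ , _ , _} {_ , _ , _} {_ , _ , _} (da , db , dc) (ea , eb , ec) =
    ≡ₚ-trans da ea , ≡ₚ-trans db eb , ≡ₚ-trans dc ec

  private
    triple : ∀ {a a' b b' c c' : ℤ} → a ≡ a' → b ≡ b' → c ≡ c' → (a , b , c) ≡ (a' , b' , c')
    triple refl refl refl = refl

  ·-assoc : ∀ x y z → (x · y) · z ≡ x · (y · z)
  ·-assoc (a , b , c) (a' , b' , c') (a'' , b'' , c'') =
    triple (+-assoc a a' a'') (+-assoc b b' b'') (central a b c a' b' c' a'' b'' c'')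
    where
    +-assoc : ∀ a a' a'' → (a + a') + a'' ≡ a + (a' + a'')
    +-assoc = solve-∀
    central : ∀ a b c a' b' c' a'' b'' c'' →
      c + c' + (a * b' - a' * b) + c'' + ((a + a') * b'' - a'' * (b + b'))
        ≡ c + (c' + c'' + (a' * b'' - a'' * b')) + (a * (b' + b'') - (a' + a'') * b)
    central = solve-∀

  ·-identityˡ : ∀ x → ε · x ≡ x
  ·-identityˡ (a , b , c) = triple (identity a) (identity b) (central a b c)
    where
    identity : ∀ a → 0ℤ + a ≡ a
    identity = solve-∀
    central : ∀ a b c → 0ℤ + c + (0ℤ * b - a * 0ℤ) ≡ c
    central = solve-∀

  ·-identityʳ : ∀ x → x · ε ≡ x
  ·-identityʳ (a , b , c) = triple (identity a) (identity b) (central a b c)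
    where
    identity : ∀ a → a + 0ℤ ≡ a
    identity = solve-∀
    central : ∀ a b c → c + 0ℤ + (a * 0ℤ - 0ℤ * b) ≡ c
    central = solve-∀

  ·-inverseˡ : ∀ x → x ⁻¹ · x ≡ ε
  ·-inverseˡ (a , b , c) = triple (inverse a) (inverse b) (central a b c)
    where
    inverse : ∀ a → - a + a ≡ 0ℤ
    inverse = solve-∀
    central : ∀ a b c → - c + c + (- a * b - a * - b) ≡ 0ℤ
    central = solve-∀

  ·-inverseʳ : ∀ x → x · x ⁻¹ ≡ ε
  ·-inverseʳ (a , b , c) = triple (inverse a) (inverse b) (central a b c)
    where
    inverse : ∀ a → a + - a ≡ 0ℤ
    inverse = solve-∀
    central : ∀ a b c → c + - c + (a * - b - - a * b) ≡ 0ℤ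
    central = solve-∀

  ·-cong : ∀ {x x' y y'} → x ≈ x' → y ≈ y' → x · y ≈ x' · y'
  ·-cong {a , b , _} {a' , b' , _} {u , v , _} {u' , v' , _} (da , db , dc) (du , dv , dw) =
    +-cong da du , +-cong db dv ,
    +-cong (+-cong dc dw) (+-cong (*-cong da dv) (-‿cong (*-cong du db)))

  ⁻¹-cong : ∀ {x x'} → x ≈ x' → x ⁻¹ ≈ x' ⁻¹
  ⁻¹-cong {_ , _ , _} {_ , _ , _} (da , db , dc) = -‿cong da , -‿cong db , -‿cong dc

  heisenberg : Group 0ℓ 0ℓ
  heisenberg = record
    { Carrier = H₃
    ; _≈_ = _≈_
    ; _∙_ = _·_
    ; ε = ε
    ; _⁻¹ = _⁻¹
    ; isGroup = record
      { isMonoid = record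
        { isSemigroup = record
          { isMagma = record
            { isEquivalence = record
              { refl = ≈-reflexive refl ; sym = ≈-sym ; trans = ≈-trans }
            ; ∙-cong = ·-cong
            }
          ; assoc = λ x y z → ≈-reflexive (·-assoc x y z)
          }
        ; identity = (λ x → ≈-reflexive (·-identityˡ x)) , (λ x → ≈-reflexive (·-identityʳ x))
        }
      ; inverse = (λ x → ≈-reflexive (·-inverseˡ x)) , (λ x → ≈-reflexive (·-inverseʳ x))
      ; ⁻¹-cong = ⁻¹-cong
      }
    }

  comm-formula : ∀ x y → comm heisenberg x y ≡ (0ℤ , 0ℤ , ω x y + ω x y)
  comm-formula (a , b , c) (a' , b' , c') =
    triple (cancel a a') (cancel b b') (central a b c a' b' c')
    where
    cancel : ∀ a a' → - a + - a' + a + a' ≡ 0ℤ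
    cancel = solve-∀
    central : ∀ a b c a' b' c' →
      let u₁ = - a + - a' ; u₂ = - b + - b'
          u₃ = - c + - c' + (- a * - b' - - a' * - b)
          v₁ = u₁ + a ; v₂ = u₂ + b
          v₃ = u₃ + c + (u₁ * b - a * u₂)
      in v₃ + c' + (v₁ * b' - a' * v₂) ≡ (a * b' - a' * b) + (a * b' - a' * b)
    central = solve-∀

  ω-central : ∀ c z → ω (0ℤ , 0ℤ , c) z ≡ 0ℤ
  ω-central c (a , b , _) = annihilate a b
    where
    annihilate : ∀ a b → 0ℤ * b - a * 0ℤ ≡ 0ℤ
    annihilate = solve-∀

  nilpotent : Nilpotent2 heisenberg
  nilpotent x y z = ≈-reflexive (begin
    comm heisenberg [x,y] z            ≡⟨ comm-formula [x,y] z ⟩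
    (0ℤ , 0ℤ , ω [x,y] z + ω [x,y] z)  ≡⟨ cong (λ k → (0ℤ , 0ℤ , k + k)) ω[x,y]z≡0 ⟩
    ε                                  ∎)
    where
    open ≡-Reasoning
    [x,y] = comm heisenberg x y
    ω[x,y]z≡0 : ω [x,y] z ≡ 0ℤ
    ω[x,y]z≡0 = trans (cong (λ u → ω u z) (comm-formula x y)) (ω-central (ω x y + ω x y) z)

  ^'-formula : ∀ a b c n → _^'_ heisenberg (a , b , c) n ≡ (+ n * a , + n * b , + n * c)
  ^'-formula a b c zero = triple (zero* a) (zero* b) (zero* c)
    where
    zero* : ∀ a → 0ℤ ≡ 0ℤ * a
    zero* = solve-∀
  ^'-formula a b c (suc n) = begin
    (a , b , c) · _^'_ heisenberg (a , b , c) n  ≡⟨ cong ((a , b , c) ·_) (^'-formula a b c n) ⟩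
    (a , b , c) · (+ n * a , + n * b , + n * c)
      ≡⟨ triple (suc* a (+ n)) (suc* b (+ n)) (central a b c (+ n)) ⟩
    (+ suc n * a , + suc n * b , + suc n * c)    ∎
    where
    open ≡-Reasoning
    suc* : ∀ a n → a + n * a ≡ (1ℤ + n) * a
    suc* = solve-∀
    central : ∀ a b c n → c + n * c + (a * (n * b) - n * a * b) ≡ (1ℤ + n) * c
    central = solve-∀

  exponent : ExponentDivides heisenberg p
  exponent (a , b , c) = ≈-trans (≈-reflexive (^'-formula a b c p)) (p*≡ₚ0 a , p*≡ₚ0 b , p*≡ₚ0 c)
    where
    p*≡ₚ0 : ∀ a → + p * a ≡ₚ 0ℤ
    p*≡ₚ0 a = ∣-resp (identity a (+ p)) (divides a refl)
      where
      identity : ∀ a p → a * p ≡ p * a - 0ℤ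
      identity = solve-∀

  heisenberg-inVariety : InVariety heisenberg p
  heisenberg-inVariety = nilpotent , exponent

  X Y : H₃
  X = (1ℤ , 0ℤ , 0ℤ)
  Y = (0ℤ , 1ℤ , 0ℤ)

  comm-X-Y≉ε : ¬ p ∣ 2 → ¬ comm heisenberg X Y ≈ ε
  comm-X-Y≉ε p∤2 (_ , _ , mod-p p∣2) = p∤2 (∣⇒∣ᵤ p∣2)

module WordGroup (K : Group 0ℓ 0ℓ) {V : Set} (Label : V → Group.Carrier K → Set)
                 (label-functional : ∀ {v g h} → Label v g → Label v h → Group._≈_ K g h)
                 (label-total : ∀ v → ¬ ¬ ∃ (Label v)) where
  open Group K
  open import Algebra.Properties.Group K using (ε⁻¹≈ε; ⁻¹-involutive; ⁻¹-anti-homo-∙)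
  open import Relation.Binary.Reasoning.Setoid setoid
  open RawMonad (¬¬-Monad {0ℓ}) using (_>>=_; pure)
  open List using (List; []; _∷_; _++_; [_])

  Word : Set
  Word = List (V × Bool)

  signed : Bool → Carrier → Carrier
  signed true  g = g
  signed false g = g ⁻¹

  infix 4 _⇓_
  data _⇓_ : Word → Carrier → Set where
    []  : ∀ {r} → r ≈ ε → [] ⇓ r
    _∷_ : ∀ {v b w g s r} → Label v g × r ≈ signed b g ∙ s → w ⇓ s → ((v , b) ∷ w) ⇓ r

  ⇓-resp-≈ : ∀ {w r s} → r ≈ s → w ⇓ r → w ⇓ s
  ⇓-resp-≈ r≈s ([] r≈ε)          = [] (trans (sym r≈s) r≈ε)
  ⇓-resp-≈ r≈s ((l , r≈) ∷ w⇓t) = (l , trans (sym r≈s) r≈) ∷ w⇓t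

  signed-cong : ∀ b {g h} → g ≈ h → signed b g ≈ signed b h
  signed-cong true  g≈h = g≈h
  signed-cong false g≈h = ⁻¹-cong g≈h

  signed-not : ∀ b g → signed (not b) g ≈ signed b g ⁻¹
  signed-not true  g = refl
  signed-not false g = sym (⁻¹-involutive g)

  ⇓-functional : ∀ {w r s} → w ⇓ r → w ⇓ s → r ≈ s
  ⇓-functional ([] r≈ε) ([] s≈ε) = trans r≈ε (sym s≈ε)
  ⇓-functional ((_∷_ {b = b} (l , r≈) w⇓t)) ((l' , s≈) ∷ w⇓t') =
    trans r≈ (trans (∙-cong (signed-cong b (label-functional l l')) (⇓-functional w⇓t w⇓t'))
                    (sym s≈))

  ⇓-total : ∀ w → ¬ ¬ ∃ (w ⇓_)
  ⇓-total []            = pure (ε , [] refl)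
  ⇓-total ((v , b) ∷ w) = do
    (g , l)   ← label-total v
    (s , w⇓s) ← ⇓-total w
    pure (signed b g ∙ s , (l , refl) ∷ w⇓s)

  ⇓-letter : ∀ {v g} b → Label v g → [ (v , b) ] ⇓ signed b g
  ⇓-letter b l = (l , sym (identityʳ _)) ∷ [] refl

  ⇓-++ : ∀ {w w' r s} → w ⇓ r → w' ⇓ s → (w ++ w') ⇓ (r ∙ s)
  ⇓-++ {r = r} {s} ([] r≈ε) w'⇓s = ⇓-resp-≈ (begin
    s     ≈⟨ identityˡ s ⟨
    ε ∙ s ≈⟨ ∙-congʳ r≈ε ⟨
    r ∙ s ∎) w'⇓s
  ⇓-++ {r = r} {s} (_∷_ {b = b} {g = g} {s = t} (l , r≈) w⇓t) w'⇓s = (l , (begin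
    r ∙ s                  ≈⟨ ∙-congʳ r≈ ⟩
    (signed b g ∙ t) ∙ s   ≈⟨ assoc _ t s ⟩
    signed b g ∙ (t ∙ s)   ∎)) ∷ ⇓-++ w⇓t w'⇓s

  invert : Word → Word
  invert []            = []
  invert ((v , b) ∷ w) = invert w ++ [ (v , not b) ]

  ⇓-invert : ∀ {w r} → w ⇓ r → invert w ⇓ r ⁻¹
  ⇓-invert ([] r≈ε) = [] (trans (⁻¹-cong r≈ε) ε⁻¹≈ε)
  ⇓-invert {r = r} (_∷_ {b = b} {g = g} {s = t} (l , r≈) w⇓t) = ⇓-resp-≈ (begin
    t ⁻¹ ∙ signed (not b) g    ≈⟨ ∙-congˡ (signed-not b g) ⟩
    t ⁻¹ ∙ signed b g ⁻¹       ≈⟨ ⁻¹-anti-homo-∙ (signed b g) t ⟨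
    (signed b g ∙ t) ⁻¹        ≈⟨ ⁻¹-cong r≈ ⟨
    r ⁻¹                       ∎)
    (⇓-++ (⇓-invert w⇓t) (⇓-letter (not b) l))

  -- Evaluations exist only under ¬¬, as labels need not be decidable.
  infix 4 _≈ʷ_
  record _≈ʷ_ (w w' : Word) : Set where
    constructor mk≈ʷ
    field compare : ∀ {r s} → w ⇓ r → w' ⇓ s → ¬ ¬ r ≈ s
  open _≈ʷ_ public

  ≈ʷ-intro : ∀ {w w' r s} → w ⇓ r → w' ⇓ s → r ≈ s → w ≈ʷ w'
  ≈ʷ-intro w⇓r w'⇓s r≈s = mk≈ʷ λ w⇓r' w'⇓s' →
    pure (trans (⇓-functional w⇓r' w⇓r) (trans r≈s (⇓-functional w'⇓s w'⇓s')))

  ≈ʷ-stable : ∀ {w w'} → ¬ ¬ w ≈ʷ w' → w ≈ʷ w'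
  ≈ʷ-stable ¬¬w≈w' = mk≈ʷ λ w⇓r w'⇓s → ¬¬w≈w' >>= λ w≈w' → compare w≈w' w⇓r w'⇓s

  ≈ʷ-refl : ∀ {w} → w ≈ʷ w
  ≈ʷ-refl = mk≈ʷ λ w⇓r w⇓s → pure (⇓-functional w⇓r w⇓s)

  ≈ʷ-reflexive : ∀ {w w'} → w ≡ w' → w ≈ʷ w'
  ≈ʷ-reflexive ≡.refl = ≈ʷ-refl

  ≈ʷ-sym : ∀ {w w'} → w ≈ʷ w' → w' ≈ʷ w
  ≈ʷ-sym w≈w' = mk≈ʷ λ w'⇓r w⇓s → ¬¬-map sym (compare w≈w' w⇓s w'⇓r)

  ≈ʷ-trans : ∀ {w₁ w₂ w₃} → w₁ ≈ʷ w₂ → w₂ ≈ʷ w₃ → w₁ ≈ʷ w₃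
  ≈ʷ-trans {w₂ = w₂} w₁≈w₂ w₂≈w₃ = mk≈ʷ λ w₁⇓r w₃⇓s → do
    (t , w₂⇓t) ← ⇓-total w₂
    r≈t ← compare w₁≈w₂ w₁⇓r w₂⇓t
    t≈s ← compare w₂≈w₃ w₂⇓t w₃⇓s
    pure (trans r≈t t≈s)

  ++-cong : ∀ {x y u v} → x ≈ʷ y → u ≈ʷ v → (x ++ u) ≈ʷ (y ++ v)
  ++-cong {x} {y} {u} {v} x≈y u≈v = ≈ʷ-stable do
    (rx , x⇓rx) ← ⇓-total x
    (ry , y⇓ry) ← ⇓-total y
    (ru , u⇓ru) ← ⇓-total u
    (rv , v⇓rv) ← ⇓-total v
    rx≈ry ← compare x≈y x⇓rx y⇓ry
    ru≈rv ← compare u≈v u⇓ru v⇓rv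
    pure (≈ʷ-intro (⇓-++ x⇓rx u⇓ru) (⇓-++ y⇓ry v⇓rv) (∙-cong rx≈ry ru≈rv))

  invert-cong : ∀ {x y} → x ≈ʷ y → invert x ≈ʷ invert y
  invert-cong {x} {y} x≈y = ≈ʷ-stable do
    (rx , x⇓rx) ← ⇓-total x
    (ry , y⇓ry) ← ⇓-total y
    rx≈ry ← compare x≈y x⇓rx y⇓ry
    pure (≈ʷ-intro (⇓-invert x⇓rx) (⇓-invert y⇓ry) (⁻¹-cong rx≈ry))

  invert-inverseˡ : ∀ x → (invert x ++ x) ≈ʷ []
  invert-inverseˡ x = ≈ʷ-stable do
    (rx , x⇓rx) ← ⇓-total x
    pure (≈ʷ-intro (⇓-++ (⇓-invert x⇓rx) x⇓rx) ([] refl) (inverseˡ rx))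

  invert-inverseʳ : ∀ x → (x ++ invert x) ≈ʷ []
  invert-inverseʳ x = ≈ʷ-stable do
    (rx , x⇓rx) ← ⇓-total x
    pure (≈ʷ-intro (⇓-++ x⇓rx (⇓-invert x⇓rx)) ([] refl) (inverseʳ rx))

  wordGroup : Group 0ℓ 0ℓ
  wordGroup = record
    { Carrier = Word
    ; _≈_ = _≈ʷ_
    ; _∙_ = _++_
    ; ε = []
    ; _⁻¹ = invert
    ; isGroup = record
      { isMonoid = record
        { isSemigroup = record
          { isMagma = record
            { isEquivalence = record { refl = ≈ʷ-refl ; sym = ≈ʷ-sym ; trans = ≈ʷ-trans }
            ; ∙-cong = ++-cong
            }
          ; assoc = λ x y z → ≈ʷ-reflexive (++-assoc x y z)
          }
        ; identity = (λ _ → ≈ʷ-refl) , (λ x → ≈ʷ-reflexive (++-identityʳ x))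
        }
      ; inverse = invert-inverseˡ , invert-inverseʳ
      ; ⁻¹-cong = invert-cong
      }
    }

  ⇓-comm : ∀ {x y r s} → x ⇓ r → y ⇓ s → comm wordGroup x y ⇓ comm K r s
  ⇓-comm x⇓r y⇓s = ⇓-++ (⇓-++ (⇓-++ (⇓-invert x⇓r) (⇓-invert y⇓s)) x⇓r) y⇓s

  ⇓-^ : ∀ {x r} n → x ⇓ r → _^'_ wordGroup x n ⇓ _^'_ K r n
  ⇓-^ zero    x⇓r = [] refl
  ⇓-^ (suc n) x⇓r = ⇓-++ x⇓r (⇓-^ n x⇓r)

  wordGroup-inVariety : ∀ {p} → InVariety K p → InVariety wordGroup p
  wordGroup-inVariety {p} (nilpotent , exponent) = nilpotent′ , exponent′
    where
    nilpotent′ : Nilpotent2 wordGroup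
    nilpotent′ x y z = ≈ʷ-stable do
      (rx , x⇓rx) ← ⇓-total x
      (ry , y⇓ry) ← ⇓-total y
      (rz , z⇓rz) ← ⇓-total z
      pure (≈ʷ-intro (⇓-comm (⇓-comm x⇓rx y⇓ry) z⇓rz) ([] refl) (nilpotent rx ry rz))
    exponent′ : ExponentDivides wordGroup p
    exponent′ x = ≈ʷ-stable do
      (rx , x⇓rx) ← ⇓-total x
      pure (≈ʷ-intro (⇓-^ p x⇓rx) ([] refl) (exponent rx))

  generator : V → Word
  generator v = [ (v , true) ]

  generators-commute : ∀ {v w} → (∀ {g h} → Label v g → Label w h → g ∙ h ≈ h ∙ g) →
                       (generator v ++ generator w) ≈ʷ (generator w ++ generator v)
  generators-commute {v} {w} labels-commute = ≈ʷ-stable do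
    (g , lv) ← label-total v
    (h , lw) ← label-total w
    pure (≈ʷ-intro (⇓-++ (⇓-letter true lv) (⇓-letter true lw))
                   (⇓-++ (⇓-letter true lw) (⇓-letter true lv)) (labels-commute lv lw))

  generator-trivial : ∀ {v} → (∀ {g} → Label v g → g ≈ ε) → generator v ≈ʷ []
  generator-trivial {v} trivial = ≈ʷ-stable do
    (g , lv) ← label-total v
    pure (≈ʷ-intro (⇓-letter true lv) ([] refl) (trivial lv))

module TwoPointLabel (C : Graph) (K : Group 0ℓ 0ℓ) {A B : Graph.Vertex C} (A≢B : A ≢ B)
                     (a b : Group.Carrier K) where
  open Graph C
  open Group K
  open RawMonad (¬¬-Monad {0ℓ}) using (_>>=_; pure)

  data Label (v : Vertex) : Carrier → Set where
    at-A      : v ≡ A → Label v a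
    at-B      : v ≡ B → Label v b
    elsewhere : v ≢ A → v ≢ B → Label v ε

  label-functional : ∀ {v g h} → Label v g → Label v h → g ≈ h
  label-functional (at-A _)         (at-A _)         = refl
  label-functional (at-B _)         (at-B _)         = refl
  label-functional (elsewhere _ _)  (elsewhere _ _)  = refl
  label-functional (at-A ≡.refl)    (at-B v≡B)       = ⊥-elim (A≢B v≡B)
  label-functional (at-B ≡.refl)    (at-A v≡A)       = ⊥-elim (A≢B (≡.sym v≡A))
  label-functional (at-A v≡A)       (elsewhere v≢A _) = ⊥-elim (v≢A v≡A)
  label-functional (at-B v≡B)       (elsewhere _ v≢B) = ⊥-elim (v≢B v≡B)
  label-functional (elsewhere v≢A _) (at-A v≡A)      = ⊥-elim (v≢A v≡A)
  label-functional (elsewhere _ v≢B) (at-B v≡B)      = ⊥-elim (v≢B v≡B)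

  label-total : ∀ v → ¬ ¬ ∃ (Label v)
  label-total v = do
    v≟A ← ¬¬-excluded-middle
    v≟B ← ¬¬-excluded-middle
    pure (classify v≟A v≟B)
    where
    classify : Dec (v ≡ A) → Dec (v ≡ B) → ∃ (Label v)
    classify (yes v≡A) _         = a , at-A v≡A
    classify (no v≢A)  (yes v≡B) = b , at-B v≡B
    classify (no v≢A)  (no v≢B)  = ε , elsewhere v≢A v≢B

  labels-commute : ¬ A ~ B → ∀ {v w g h} → v ~ w → Label v g → Label w h → g ∙ h ≈ h ∙ g
  labels-commute A≁B v~w (at-A ≡.refl) (at-B ≡.refl) = ⊥-elim (A≁B v~w)
  labels-commute A≁B v~w (at-B ≡.refl) (at-A ≡.refl) = ⊥-elim (A≁B (~-sym v~w))
  labels-commute A≁B v~w (at-A _) (at-A _) = refl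
  labels-commute A≁B v~w (at-B _) (at-B _) = refl
  labels-commute A≁B v~w (elsewhere _ _) _ = trans (identityˡ _) (sym (identityʳ _))
  labels-commute A≁B v~w (at-A _) (elsewhere _ _) = trans (identityʳ _) (sym (identityˡ _))
  labels-commute A≁B v~w (at-B _) (elsewhere _ _) = trans (identityʳ _) (sym (identityˡ _))

record Isolation {C : Graph} {G : Group 0ℓ 0ℓ} (ι : Graph.Vertex C → Group.Carrier G)
                 (A B : Graph.Vertex C) : Set₁ where
  field
    H              : Group 0ℓ 0ℓ
    h              : Group.Carrier G → Group.Carrier H
    h-hom          : IsGroupHom G H h
    h-trivial      : ∀ v → v ≢ A → v ≢ B → Group._≈_ H (h (ι v)) (Group.ε H)
    h-noncommuting : ¬ Group._≈_ H (comm H (h (ι A)) (h (ι B))) (Group.ε H)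

isolation : ∀ {p C G ι} → IsM p C G ι → ¬ p ∣ 2 →
            ∀ {A B} → A ≢ B → ¬ Graph._~_ C A B → Isolation {C} {G} ι A B
isolation {p} {C} {G} {ι} isM p∤2 {A} {B} A≢B A≁B = record
  { H = wordGroup ; h = h ; h-hom = h-hom
  ; h-trivial = h-trivial ; h-noncommuting = h-noncommuting }
  where
  open Heisenberg p using (heisenberg; heisenberg-inVariety; X; Y; comm-X-Y≉ε)
  open TwoPointLabel C heisenberg A≢B X Y
  open WordGroup heisenberg Label label-functional label-total
  open CommutatorProducts wordGroup using (comm-cong)

  universal = IsM.universal isM wordGroup (wordGroup-inVariety {p} heisenberg-inVariety) generator
                (λ v~w → generators-commute (labels-commute A≁B v~w))
  h = proj₁ universal
  h-hom = proj₁ (proj₂ universal)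

  h-ι : ∀ v → h (ι v) ≈ʷ generator v
  h-ι = proj₂ (proj₂ universal)

  h-trivial : ∀ v → v ≢ A → v ≢ B → h (ι v) ≈ʷ List.[]
  h-trivial v v≢A v≢B =
    ≈ʷ-trans (h-ι v) (generator-trivial λ l → label-functional l (elsewhere v≢A v≢B))

  h-noncommuting : ¬ comm wordGroup (h (ι A)) (h (ι B)) ≈ʷ List.[]
  h-noncommuting [A,B]≈ε =
    compare (≈ʷ-trans (≈ʷ-sym (comm-cong (h-ι A) (h-ι B))) [A,B]≈ε)
      (⇓-comm (⇓-letter true (at-A ≡.refl)) (⇓-letter true (at-B ≡.refl)))
      ([] (Group.refl heisenberg))
      (comm-X-Y≉ε p∤2)

module _ {A : Set} where
  open Nat using (_+_)
  open Vector using (_∷_)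

  -- Not Vector._++_: this recursion mirrors that of ∃ⁿ, so Sat-∃ⁿ holds without extensionality.
  infixr 5 _⊕_
  _⊕_ : ∀ {k n} → (Fin k → A) → (Fin n → A) → Fin (k + n) → A
  _⊕_ {zero}  τ ρ = ρ
  _⊕_ {suc k} τ ρ = τ zero ∷ ((λ i → τ (suc i)) ⊕ ρ)

  ⊕-↑ˡ : ∀ {k n} (τ : Fin k → A) (ρ : Fin n → A) i → (τ ⊕ ρ) (i ↑ˡ n) ≡ τ i
  ⊕-↑ˡ τ ρ zero    = ≡.refl
  ⊕-↑ˡ τ ρ (suc i) = ⊕-↑ˡ (λ i → τ (suc i)) ρ i

  ⊕-↑ʳ : ∀ {k n} (τ : Fin k → A) (ρ : Fin n → A) j → (τ ⊕ ρ) (k ↑ʳ j) ≡ ρ j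
  ⊕-↑ʳ {zero}  τ ρ j = ≡.refl
  ⊕-↑ʳ {suc k} τ ρ j = ⊕-↑ʳ (λ i → τ (suc i)) ρ j

∃ⁿ : ∀ k {n} → Formula (k Nat.+ n) → Formula n
∃ⁿ zero    φ = φ
∃ⁿ (suc k) φ = ∃ⁿ k (exi φ)

∏ᵗ : ∀ {k n} → (Fin k → Term n) → Term n
∏ᵗ = Vector.foldr mul one

commᵗ : ∀ {n} → Term n → Term n → Term n
commᵗ s t = mul (mul (mul (inv s) (inv t)) s) t

commProductᵗ : ∀ {m n k} → (Fin m → Term k) → (Fin m → Fin n → Term k) → Term k
commProductᵗ t w = ∏ᵗ λ i → ∏ᵗ λ b → commᵗ (t i) (w i b)

module Evaluation (G : Group 0ℓ 0ℓ) where
  open Group G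
  open CommutatorProducts G using (sum; commProduct)
  open import Algebra.Properties.Monoid.Sum monoid using (sum-cong-≗)
  open Nat using (_+_)
  open Vector using (_∷_)

  Sat-∃ⁿ : ∀ k {n} (φ : Formula (k + n)) (ρ : Fin n → Carrier) →
           Sat G (∃ⁿ k φ) ρ ⇔ ∃ λ τ → Sat G φ (τ ⊕ ρ)
  Sat-∃ⁿ zero    φ ρ = mk⇔ (λ s → (λ ()) , s) (λ (_ , s) → s)
  Sat-∃ⁿ (suc k) φ ρ = mk⇔
    (λ s → let (τ , t , s') = Equivalence.to (Sat-∃ⁿ k (exi φ) ρ) s in (t ∷ τ) , s')
    (λ (τ , s) → Equivalence.from (Sat-∃ⁿ k (exi φ) ρ) ((λ i → τ (suc i)) , τ zero , s))

  eval-∏ᵗ : ∀ {k n} (ρ : Fin n → Carrier) (S : Fin k → Term n) →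
            eval G ρ (∏ᵗ S) ≡ sum (λ i → eval G ρ (S i))
  eval-∏ᵗ {zero}  ρ S = ≡.refl
  eval-∏ᵗ {suc k} ρ S = ≡.cong (eval G ρ (S zero) ∙_) (eval-∏ᵗ ρ (λ i → S (suc i)))

  eval-commProductᵗ : ∀ {m n k} (ρ : Fin k → Carrier) t (w : Fin m → Fin n → Term k) →
    eval G ρ (commProductᵗ t w) ≡ commProduct (λ i → eval G ρ (t i)) (λ i b → eval G ρ (w i b))
  eval-commProductᵗ ρ t w =
    ≡.trans (eval-∏ᵗ ρ (λ i → ∏ᵗ λ b → commᵗ (t i) (w i b)))
            (sum-cong-≗ λ i → eval-∏ᵗ ρ (λ b → commᵗ (t i) (w i b)))

module Row (m n : ℕ) where
  open Nat using (_+_; _*_)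
  private
    Scope : ℕ
    Scope = m + suc (suc (m * n))
    x̂ ŷ : Term Scope
    x̂ = var (m ↑ʳ zero)
    ŷ = var (m ↑ʳ suc zero)
    t̂ : Fin m → Term Scope
    t̂ i = var (i ↑ˡ _)
    ŵ : Fin m → Fin n → Term Scope
    ŵ i b = var (m ↑ʳ suc (suc (combine i b)))

    body : Fin m → Formula Scope
    body i = conj (eq x̂ (commProductᵗ t̂ ŵ)) (eq (t̂ i) ŷ)

  formula : Fin m → Formula (suc (suc (m * n)))
  formula i = ∃ⁿ m (body i)

  module Semantics (G : Group 0ℓ 0ℓ) where
    open Group G
    open CommutatorProducts G using (commProduct; commProduct-cong)
    open Evaluation G
    open Vector using (_∷_)

    Sat-body : ∀ i x y (w : Fin (m * n) → Carrier) {τ} →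
      Sat G (body i) (τ ⊕ (x ∷ y ∷ w)) ⇔ (x ≈ commProduct τ (λ i' b → w (combine i' b)) × τ i ≈ y)
    Sat-body i x y w {τ} = mk⇔
      (λ (x̂≈P , t̂≈ŷ) → trans (sym x-lookup) (trans x̂≈P product) ,
                        trans (sym t-lookup) (trans t̂≈ŷ y-lookup))
      (λ (x≈P , τi≈y) → trans x-lookup (trans x≈P (sym product)) ,
                        trans t-lookup (trans τi≈y (sym y-lookup)))
      where
      ρ = τ ⊕ (x ∷ y ∷ w)
      x-lookup : ρ (m ↑ʳ zero) ≈ x
      x-lookup = reflexive (⊕-↑ʳ τ (x ∷ y ∷ w) zero)
      y-lookup : ρ (m ↑ʳ suc zero) ≈ y
      y-lookup = reflexive (⊕-↑ʳ τ (x ∷ y ∷ w) (suc zero))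
      t-lookup : ρ (i ↑ˡ _) ≈ τ i
      t-lookup = reflexive (⊕-↑ˡ τ (x ∷ y ∷ w) i)
      product : eval G ρ (commProductᵗ t̂ ŵ) ≈ commProduct τ (λ i' b → w (combine i' b))
      product = trans (reflexive (eval-commProductᵗ ρ t̂ ŵ)) (commProduct-cong
        (λ i' → reflexive (⊕-↑ˡ τ (x ∷ y ∷ w) i'))
        (λ i' b → reflexive (⊕-↑ʳ τ (x ∷ y ∷ w) (suc (suc (combine i' b))))))

    Sat-formula : ∀ i x y (w : Fin (m * n) → Carrier) →
      Sat G (formula i) (x ∷ y ∷ w) ⇔ ∃ λ τ → x ≈ commProduct τ (λ i' b → w (combine i' b)) × τ i ≈ y
    Sat-formula i x y w =
      ⇔-trans (Sat-∃ⁿ m (body i) (x ∷ y ∷ w)) (∃-congˡ {k = equivalence} (Sat-body i x y w))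

toℕ≢+ : ∀ {n} (i : Fin n) j → toℕ i ≢ n Nat.+ j
toℕ≢+ {n} i j = <⇒≢ (<-≤-trans (toℕ<n i) (m≤m+n n j))

toℕ⊎+-injective : ∀ n → Injective _≡_ _≡_ [ toℕ {n} , n Nat.+_ ]′
toℕ⊎+-injective n {inj₁ i} {inj₁ j} same = ≡.cong inj₁ (toℕ-injective same)
toℕ⊎+-injective n {inj₂ i} {inj₂ j} same = ≡.cong inj₂ (+-cancelˡ-≡ n _ _ same)
toℕ⊎+-injective n {inj₁ i} {inj₂ j} same = ⊥-elim (toℕ≢+ i j same)
toℕ⊎+-injective n {inj₂ j} {inj₁ i} same = ⊥-elim (toℕ≢+ i j (≡.sym same))

module Pattern {p : ℕ} {C : Graph} {G : Group 0ℓ 0ℓ} {ι : Graph.Vertex C → Group.Carrier G}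
               (isM : IsM p C G ι) (p∤2 : ¬ p ∣ 2) (noSquares : NoSquares C)
               (e : ℕ → Graph.Vertex C) (e-injective : Injective _≡_ _≡_ e) (m : ℕ) where
  open Graph C
  open Group G
  open CommutatorProducts G using (commProduct)
  open Row.Semantics m 2 G using (Sat-formula)
  open Nat using (_*_)
  open Vector using (_∷_)
  open Equivalence

  vertex : Fin (m * 2) ⊎ ℕ → Vertex
  vertex k = e ([ toℕ , (m * 2) Nat.+_ ]′ k)

  vertex-injective : Injective _≡_ _≡_ vertex
  vertex-injective same = toℕ⊎+-injective (m * 2) (e-injective same)

  W : Fin m → Fin 2 → Vertex
  W i b = vertex (inj₁ (combine i b))

  U : ℕ → Vertex
  U j = vertex (inj₂ j)

  U≢W : ∀ {j i b} → U j ≢ W i b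
  U≢W {j} {i} {b} same with vertex-injective {inj₂ j} {inj₁ (combine i b)} same
  ... | ()

  U-injective : ∀ {j j'} → U j ≡ U j' → j ≡ j'
  U-injective same = inj₂-injective (vertex-injective same)

  W-injective : ∀ {i b i' b'} → W i b ≡ W i' b' → (i , b) ≡ (i' , b')
  W-injective {i} {b} {i'} {b'} same =
    ×-≡,≡→≡ (combine-injective i b i' b' (inj₁-injective (vertex-injective same)))

  ιW : Fin m → Fin 2 → Carrier
  ιW i b = ι (W i b)

  parameters : ℕ → Fin (suc (m * 2)) → Carrier
  parameters j = ι (U j) ∷ λ k → ι (vertex (inj₁ k))

  Solution : Fin m → ℕ → Carrier → Set
  Solution i j x = ∃ λ τ → x ≈ commProduct τ ιW × τ i ≈ ι (U j)

  solutions-force-adjacency : ∀ {i j j' x} → j ≢ j' → Solution i j x → Solution i j' x →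
                              ∀ b → ¬ ¬ U j ~ W i b
  solutions-force-adjacency {i} {j} {j'} {x} j≢j' (τ , x≈τ , τi≈) (τ' , x≈τ' , τ'i≈) b U≁W =
    h-noncommuting (begin
      comm H (h (ι (U j))) (h (ιW i b))   ≈⟨ comm-cong (⟦⟧-cong (sym τi≈)) H.refl ⟩
      comm H (h (τ i)) (h (ιW i b))       ≈⟨ image x≈τ ⟨
      h x                                 ≈⟨ image x≈τ' ⟩
      comm H (h (τ' i)) (h (ιW i b))      ≈⟨ comm-cong (⟦⟧-cong τ'i≈) H.refl ⟩
      comm H (h (ι (U j'))) (h (ιW i b))  ≈⟨ comm-cong h[U']≈ε H.refl ⟩
      comm H H.ε (h (ιW i b))             ≈⟨ comm-identityˡ (h (ιW i b)) ⟩
      H.ε                                 ∎)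
    where
    open Isolation (isolation isM p∤2 U≢W U≁W)
    module H = Group H
    open GroupMorphisms.IsGroupHomomorphism h-hom using (⟦⟧-cong)
    open CommutatorProducts H using (comm-cong; comm-identityˡ; commProduct-single)
    open CommutatorHomomorphism G H h h-hom using (commProduct-homo)
    open import Relation.Binary.Reasoning.Setoid H.setoid

    h[U']≈ε : h (ι (U j')) H.≈ H.ε
    h[U']≈ε = h-trivial (U j') (j≢j' ∘ ≡.sym ∘ U-injective) U≢W

    image : ∀ {σ} → x ≈ commProduct σ ιW → h x H.≈ comm H (h (σ i)) (h (ιW i b))
    image {σ} x≈σ = H.trans (⟦⟧-cong x≈σ) (H.trans (commProduct-homo σ ιW)
      (commProduct-single (λ i' → h (σ i')) (λ i' b' → h (ιW i' b')) i b λ i' b' ib≢ →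
         h-trivial (W i' b') (U≢W ∘ ≡.sym) (ib≢ ∘ W-injective)))

  columns-incompatible : ∀ {i j j' x} → j ≢ j' → Solution i j x → Solution i j' x → ⊥
  columns-incompatible {i} {j} {j'} j≢j' sol sol' =
    adjacent j≢j' sol sol' zero λ a₁ →
    adjacent j≢j' sol sol' (suc zero) λ a₂ →
    adjacent (j≢j' ∘ ≡.sym) sol' sol zero λ a₃ →
    adjacent (j≢j' ∘ ≡.sym) sol' sol (suc zero) λ a₄ →
    noSquares (W i zero) (U j) (W i (suc zero)) (U j')
      (λ same → case W-injective same of λ ()) (j≢j' ∘ U-injective) (~-sym a₁) a₂ (~-sym a₄) a₃
    where adjacent = solutions-force-adjacency

  row-inconsistent : ∀ i (s : Fin 2 → ℕ) → Injective _≡_ _≡_ s →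
                     ¬ (∃ λ x → ∀ t → Sat G (Row.formula m 2 i) (x ∷ parameters (s t)))
  row-inconsistent i s s-injective (x , sat) =
    columns-incompatible s₀≢s₁ (solution (sat zero)) (solution (sat (suc zero)))
    where
    solution : ∀ {j} → Sat G (Row.formula m 2 i) (x ∷ parameters j) → Solution i j x
    solution = to (Sat-formula i x _ _)
    s₀≢s₁ : s zero ≢ s (suc zero)
    s₀≢s₁ same = case s-injective same of λ ()

  inpPattern : InpPattern G m
  inpPattern = record
    { arity = λ _ → suc (m * 2)
    ; φ = Row.formula m 2
    ; a = λ _ → parameters
    ; k = λ _ → 2
    ; rowInconsistent = row-inconsistent
    ; pathConsistent = λ f → commProduct (λ i → ι (U (f i))) ιW ,
        λ i → from (Sat-formula i _ _ _) ((λ i → ι (U (f i))) , refl , refl)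
    }

odd-prime∤2 : ∀ {p} → Prime p → p ≢ 2 → ¬ p ∣ 2
odd-prime∤2 p-prime p≢2 p∣2 =
  [ nonTrivial⇒≢1 {{prime⇒nonTrivial p-prime}} , p≢2 ]′ (irreducible[2] p∣2)

proposition4p31 : (p : ℕ) → Prime p → p ≢ 2 →
    (C : Graph) → Nice C → InfiniteGraph C →
    (G : Group 0ℓ 0ℓ) (ι : Graph.Vertex C → Group.Carrier G) → IsM p C G ι →
    BurdenAtLeastℵ₀₋ G
proposition4p31 p p-prime p≢2 C nice (e , e-injective) G ι isM =
  Pattern.inpPattern isM (odd-prime∤2 p-prime p≢2) (Nice.noSquares nice) e e-injective
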